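{- Let $\rho$ be a finite-dimensional representation of $\mathrm{SL}_2(\mathbb{Z})$ that is unitary with respect to an inner product $\langle\cdot,\cdot\rangle_\rho$ on $V(\rho)$, and $M$ a positive integer. Then $T_M\rho$ is unitary with respect to the inner product on $V(\rho)\otimes\mathbb{C}[\Delta_M]$ given by $\langle v\otimes\mathfrak{e}_{m},w\otimes\mathfrak{e}_{m'}\rangle=\langle v,w\rangle_\rho$ if $m=m'$ and $=0$ otherwise.
   Context: $\Delta_M=\{\begin{pmatrix}a&b\\0&d\end{pmatrix}\in M_2(\mathbb{Z}):a,d>0,ad=M,0\le b<d\}$; each integer matrix $x$ of determinant $M$ is uniquely $x=\gamma'\overline x$ with $\gamma'\in\mathrm{SL}_2(\mathbb{Z})$, $\overline x\in\Delta_M$; $I_m(\gamma)$ is defined by $m\gamma=I_m(\gamma)\overline{m\gamma}$. $T_M\rho$ acts on $V(\rho)\otimes\mathbb{C}[\Delta_M]$ by $(T_M\rho)(\gamma)(v\otimes\mathfrak{e}_m)=\rho(I_m(\gamma^{ -1}))^{ -1}v\otimes\mathfrak{e}_{\overline{m\gamma^{ -1}}}$. -}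

module Defs where

open import Level using (Level; _⊔_; suc)
open import Data.Nat as ℕ using (ℕ; _<_)
open import Data.Integer as ℤ using (ℤ; +_; +0) renaming (_*_ to _*ℤ_; _+_ to _+ℤ_; _-_ to _-ℤ_; -_ to -ℤ_)
open import Data.Integer.Tactic.RingSolver using (solve-∀)
open import Data.Product using (_×_; _,_; proj₁; proj₂)
open import Data.List using (List; []; _∷_; map)
open import Data.Bool using (if_then_else_)
open import Relation.Nullary using (does)
open import Relation.Nullary.Decidable using (_×-dec_)
open import Relation.Binary.PropositionalEquality using (_≡_; refl; cong₂; trans)
open import Algebra.Bundles using (CommutativeRing)
open import Algebra.Module.Bundles using (LeftModule)

record M2 : Set where
  constructor mat
  field
    a b c d : ℤ

det : M2 → ℤ
det (mat a b c d) = (a *ℤ d) -ℤ (b *ℤ c)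

infixl 7 _·_
_·_ : M2 → M2 → M2
mat a b c d · mat a' b' c' d' =
  mat (a *ℤ a' +ℤ b *ℤ c') (a *ℤ b' +ℤ b *ℤ d')
      (c *ℤ a' +ℤ d *ℤ c') (c *ℤ b' +ℤ d *ℤ d')

det-· : ∀ x y → det (x · y) ≡ det x *ℤ det y
det-· (mat a b c d) (mat a' b' c' d') = lem a b c d a' b' c' d'
  where
  lem : ∀ a b c d a' b' c' d' →
        ((a *ℤ a' +ℤ b *ℤ c') *ℤ (c *ℤ b' +ℤ d *ℤ d')) -ℤ ((a *ℤ b' +ℤ b *ℤ d') *ℤ (c *ℤ a' +ℤ d *ℤ c'))
        ≡ ((a *ℤ d) -ℤ (b *ℤ c)) *ℤ ((a' *ℤ d') -ℤ (b' *ℤ c'))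
  lem = solve-∀

record SL2 : Set where
  constructor sl
  field
    m   : M2
    det≡1 : det m ≡ + 1

one : SL2
one = sl (mat (+ 1) +0 +0 (+ 1)) refl

infixl 7 _∘SL_
_∘SL_ : SL2 → SL2 → SL2
sl x px ∘SL sl y py = sl (x · y) (trans (det-· x y) (cong₂ _*ℤ_ px py))

inv-det : ∀ a b c d → (d *ℤ a) -ℤ ((-ℤ b) *ℤ (-ℤ c)) ≡ (a *ℤ d) -ℤ (b *ℤ c)
inv-det = solve-∀

_⁻¹ : SL2 → SL2
sl (mat a b c d) p ⁻¹ = sl (mat d (-ℤ b) (-ℤ c) a) (trans (inv-det a b c d) p)

record Δ (M : ℕ) : Set where
  constructor δ
  field
    a b d : ℕ
    0<a   : 0 < a
    0<d   : 0 < d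
    ad≡M  : a ℕ.* d ≡ M
    b<d   : b < d

toM2 : ∀ {M} → Δ M → M2
toM2 x = mat (+ Δ.a x) (+ Δ.b x) +0 (+ Δ.d x)

sameΔ : ∀ {M} → Δ M → Δ M → Data.Bool.Bool
sameΔ x y = does ((Δ.a x ℕ.≟ Δ.a y) ×-dec ((Δ.b x ℕ.≟ Δ.b y) ×-dec (Δ.d x ℕ.≟ Δ.d y)))

-- Any function with this specification is the
-- decomposition of the paper (it is unique); on matrices of other
-- determinant its values are irrelevant.
record Decomposition (M : ℕ) : Set where
  field
    decompose : M2 → SL2 × Δ M
    spec : ∀ x → det x ≡ + M →
           x ≡ SL2.m (proj₁ (decompose x)) · toM2 (proj₂ (decompose x))

module _ {M : ℕ} (D : Decomposition M) where
  open Decomposition D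

  I : Δ M → SL2 → SL2
  I m γ = proj₁ (decompose (toM2 m · SL2.m γ))

  bar : Δ M → SL2 → Δ M
  bar m γ = proj₂ (decompose (toM2 m · SL2.m γ))

-- Unitary representations over a scalar ring K with involution conj
-- (for the paper, K = ℂ and conj = complex conjugation).

record InnerProductSpace {c ℓ : Level} (K : CommutativeRing c ℓ)
       (conj : CommutativeRing.Carrier K → CommutativeRing.Carrier K)
       (m ℓm : Level) : Set (c ⊔ ℓ ⊔ suc (m ⊔ ℓm)) where
  open CommutativeRing K
  field
    V : LeftModule ring m ℓm
  open LeftModule V
  field
    ⟨_,_⟩     : Carrierᴹ → Carrierᴹ → Carrier
    ⟨⟩-cong   : ∀ {v v' w w'} → v ≈ᴹ v' → w ≈ᴹ w' → ⟨ v , w ⟩ ≈ ⟨ v' , w' ⟩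
    ⟨⟩-+ˡ     : ∀ u v w → ⟨ u +ᴹ v , w ⟩ ≈ ⟨ u , w ⟩ + ⟨ v , w ⟩
    ⟨⟩-*ˡ     : ∀ k v w → ⟨ k *ₗ v , w ⟩ ≈ k * ⟨ v , w ⟩
    ⟨⟩-herm   : ∀ v w → ⟨ w , v ⟩ ≈ conj ⟨ v , w ⟩

record UnitaryRep {c ℓ : Level} {K : CommutativeRing c ℓ}
       {conj : CommutativeRing.Carrier K → CommutativeRing.Carrier K}
       {m ℓm : Level} (H : InnerProductSpace K conj m ℓm)
       : Set (c ⊔ ℓ ⊔ m ⊔ ℓm) where
  open CommutativeRing K
  open InnerProductSpace H
  open LeftModule V
  field
    ρ        : SL2 → Carrierᴹ → Carrierᴹ
    ρ-cong   : ∀ γ {v w} → v ≈ᴹ w → ρ γ v ≈ᴹ ρ γ w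
    ρ-+      : ∀ γ v w → ρ γ (v +ᴹ w) ≈ᴹ ρ γ v +ᴹ ρ γ w
    ρ-*      : ∀ γ k v → ρ γ (k *ₗ v) ≈ᴹ k *ₗ ρ γ v
    ρ-one    : ∀ v → ρ one v ≈ᴹ v
    ρ-hom    : ∀ γ δ v → ρ (γ ∘SL δ) v ≈ᴹ ρ γ (ρ δ v)
    unitary  : ∀ γ v w → ⟨ ρ γ v , ρ γ w ⟩ ≈ ⟨ v , w ⟩

-- V(ρ) ⊗ ℂ[Δ_M]: an element is a finite sum Σ v_i ⊗ e_{m_i}, represented
-- by the list of its pure tensors (v_i , m_i).  T_M ρ and the inner
-- product are the (sesqui)linear extensions of the formulas on pure tensors.

module TensorDefs {c ℓ : Level} {K : CommutativeRing c ℓ}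
       {conj : CommutativeRing.Carrier K → CommutativeRing.Carrier K}
       {m ℓm : Level} {H : InnerProductSpace K conj m ℓm}
       (R : UnitaryRep H) {M : ℕ} (D : Decomposition M) where
  open CommutativeRing K
  open InnerProductSpace H
  open LeftModule V
  open UnitaryRep R

  Tensor : Set m
  Tensor = List (Carrierᴹ × Δ M)

  ⟪_,_⟫pure : Carrierᴹ × Δ M → Carrierᴹ × Δ M → Carrier
  ⟪ (v , x) , (w , y) ⟫pure = if sameΔ x y then ⟨ v , w ⟩ else 0#

  ⟪_,_⟫ : Tensor → Tensor → Carrier
  ⟪ [] , ys ⟫ = 0#
  ⟪ p ∷ xs , ys ⟫ = sumWith p ys + ⟪ xs , ys ⟫
    where
    sumWith : Carrierᴹ × Δ M → Tensor → Carrier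
    sumWith p [] = 0#
    sumWith p (q ∷ qs) = ⟪ p , q ⟫pure + sumWith p qs

  -- (T_M ρ)(γ)(v ⊗ e_m) = ρ(I_m(γ⁻¹))⁻¹ v ⊗ e_{\overline{m γ⁻¹}}
  -- (ρ(g)⁻¹ = ρ(g⁻¹) since ρ is a representation)
  Tpure : SL2 → Carrierᴹ × Δ M → Carrierᴹ × Δ M
  Tpure γ (v , x) = ρ ((I D x (γ ⁻¹)) ⁻¹) v , bar D x (γ ⁻¹)

  T : SL2 → Tensor → Tensor
  T γ = map (Tpure γ)

-- For γ ∈ SL₂(ℤ) put h = γ⁻¹.  The whole proof rests on one fact:
-- m ↦ \overline{mh} is injective on Δ_M.  Indeed, if \overline{mh} and
-- \overline{m'h} coincide, then m = q m' with q = I_m(h) I_{m'}(h)⁻¹ ∈ SL₂(ℤ),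
-- and an element of SL₂(ℤ) carrying a matrix of Δ_M into Δ_M is forced to be
-- a unipotent [[1,t],[0,1]], which then must be the identity since both
-- upper-right entries are reduced modulo the same d.
--
-- Given injectivity, T_M ρ(γ) preserves the inner product of two pure tensors:
-- the images have equal Δ_M-components exactly when the originals do, and in
-- that case their V(ρ)-components are moved by the same unitary ρ(I_m(h))⁻¹.
-- The inner product of general tensors is the double sum of the pure ones,
-- and any map of pure tensors preserving the pure inner product preserves
-- this double sum.

module Submission where

open import Defs
open import Level using (Level)
open import Data.Nat as ℕ using (ℕ; zero; suc; _<_)
import Data.Nat.Properties as ℕP
open import Data.Integer as ℤ using (ℤ; +_; +0; +[1+_]; -[1+_]; ∣_∣)
  renaming (_*_ to _*ℤ_; _+_ to _+ℤ_; _-_ to _-ℤ_; -_ to -ℤ_)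
import Data.Integer.Properties as ℤP
open import Data.Integer.Tactic.RingSolver using (solve-∀)
open import Data.Product using (_×_; _,_; proj₁; proj₂; ∃-syntax)
open import Data.Sum using (inj₁; inj₂)
open import Data.Bool using (if_then_else_)
open import Data.List using (List; []; _∷_; map)
open import Data.Empty using (⊥; ⊥-elim)
open import Relation.Nullary using (proof)
open import Relation.Nullary.Reflects using (Reflects; ofʸ; ofⁿ)
open import Relation.Nullary.Decidable using (_×-dec_; map′)
open import Relation.Binary.PropositionalEquality
  using (_≡_; refl; sym; trans; cong; cong₂; subst; module ≡-Reasoning)
open import Algebra.Bundles using (CommutativeRing)
open import Algebra.Module.Bundles using (LeftModule)
import Relation.Binary.Reasoning.Setoid as SetoidReasoning

mat≡ : ∀ {a b c d a' b' c' d'} → a ≡ a' → b ≡ b' → c ≡ c' → d ≡ d' →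
       mat a b c d ≡ mat a' b' c' d'
mat≡ refl refl refl refl = refl

𝟙 : M2
𝟙 = SL2.m one

·-assoc : ∀ x y z → (x · y) · z ≡ x · (y · z)
·-assoc (mat a b c d) (mat a' b' c' d') (mat a'' b'' c'' d'') =
  mat≡ (entry a b a' c' b' d' a'' c'') (entry a b a' c' b' d' b'' d'')
       (entry c d a' c' b' d' a'' c'') (entry c d a' c' b' d' b'' d'')
  where
  entry : ∀ a b c d c' d' e f →
          (a *ℤ c +ℤ b *ℤ d) *ℤ e +ℤ (a *ℤ c' +ℤ b *ℤ d') *ℤ f
          ≡ a *ℤ (c *ℤ e +ℤ c' *ℤ f) +ℤ b *ℤ (d *ℤ e +ℤ d' *ℤ f)
  entry = solve-∀

·-identityˡ : ∀ x → 𝟙 · x ≡ x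
·-identityˡ (mat a b c d) = mat≡ (first a c) (first b d) (second a c) (second b d)
  where
  first : ∀ u w → + 1 *ℤ u +ℤ +0 *ℤ w ≡ u
  first = solve-∀
  second : ∀ u w → +0 *ℤ u +ℤ + 1 *ℤ w ≡ w
  second = solve-∀

·-identityʳ : ∀ x → x · 𝟙 ≡ x
·-identityʳ (mat a b c d) = mat≡ (first a b) (second a b) (first c d) (second c d)
  where
  first : ∀ u w → u *ℤ + 1 +ℤ w *ℤ +0 ≡ u
  first = solve-∀
  second : ∀ u w → u *ℤ +0 +ℤ w *ℤ + 1 ≡ w
  second = solve-∀

⁻¹-inverseʳ : ∀ g → SL2.m g · SL2.m (g ⁻¹) ≡ 𝟙
⁻¹-inverseʳ (sl (mat a b c d) det≡1) =
  mat≡ (trans (diag a b c d) det≡1) (upper a b) (lower c d) (trans (diag' a b c d) det≡1)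
  where
  diag : ∀ a b c d → a *ℤ d +ℤ b *ℤ (-ℤ c) ≡ a *ℤ d -ℤ b *ℤ c
  diag = solve-∀
  upper : ∀ a b → a *ℤ (-ℤ b) +ℤ b *ℤ a ≡ +0
  upper = solve-∀
  lower : ∀ c d → c *ℤ d +ℤ d *ℤ (-ℤ c) ≡ +0
  lower = solve-∀
  diag' : ∀ a b c d → c *ℤ (-ℤ b) +ℤ d *ℤ a ≡ a *ℤ d -ℤ b *ℤ c
  diag' = solve-∀

⁻¹-inverseˡ : ∀ g → SL2.m (g ⁻¹) · SL2.m g ≡ 𝟙
⁻¹-inverseˡ (sl (mat a b c d) det≡1) =
  mat≡ (trans (diag a b c d) det≡1) (upper b d) (lower a c) (trans (diag' a b c d) det≡1)
  where
  diag : ∀ a b c d → d *ℤ a +ℤ (-ℤ b) *ℤ c ≡ a *ℤ d -ℤ b *ℤ c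
  diag = solve-∀
  upper : ∀ b d → d *ℤ b +ℤ (-ℤ b) *ℤ d ≡ +0
  upper = solve-∀
  lower : ∀ a c → (-ℤ c) *ℤ a +ℤ a *ℤ c ≡ +0
  lower = solve-∀
  diag' : ∀ a b c d → (-ℤ c) *ℤ b +ℤ a *ℤ d ≡ a *ℤ d -ℤ b *ℤ c
  diag' = solve-∀

transposeʳ : ∀ x (h : SL2) {z} → x · SL2.m h ≡ z → x ≡ z · SL2.m (h ⁻¹)
transposeʳ x h {z} xh≡z = begin
  x                             ≡⟨ sym (·-identityʳ x) ⟩
  x · 𝟙                         ≡⟨ cong (x ·_) (sym (⁻¹-inverseʳ h)) ⟩
  x · (SL2.m h · SL2.m (h ⁻¹))  ≡⟨ sym (·-assoc x (SL2.m h) (SL2.m (h ⁻¹))) ⟩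
  (x · SL2.m h) · SL2.m (h ⁻¹)  ≡⟨ cong (_· SL2.m (h ⁻¹)) xh≡z ⟩
  z · SL2.m (h ⁻¹)              ∎
  where open ≡-Reasoning

transposeˡ : ∀ (s : SL2) w {y} → y ≡ SL2.m s · w → SL2.m (s ⁻¹) · y ≡ w
transposeˡ s w {y} y≡sw = begin
  SL2.m (s ⁻¹) · y              ≡⟨ cong (SL2.m (s ⁻¹) ·_) y≡sw ⟩
  SL2.m (s ⁻¹) · (SL2.m s · w)  ≡⟨ sym (·-assoc (SL2.m (s ⁻¹)) (SL2.m s) w) ⟩
  (SL2.m (s ⁻¹) · SL2.m s) · w  ≡⟨ cong (_· w) (⁻¹-inverseˡ s) ⟩
  𝟙 · w                         ≡⟨ ·-identityˡ w ⟩
  w                             ∎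
  where open ≡-Reasoning

same-orbit : ∀ {x y b} (h s s' : SL2) →
             x · SL2.m h ≡ SL2.m s · b → y · SL2.m h ≡ SL2.m s' · b →
             x ≡ SL2.m (s ∘SL s' ⁻¹) · y
same-orbit {x} {y} {b} h s s' xh≡sb yh≡s'b = begin
  x                                    ≡⟨ transposeʳ x h xh≡sb ⟩
  (SL2.m s · b) · SL2.m (h ⁻¹)          ≡⟨ ·-assoc (SL2.m s) b (SL2.m (h ⁻¹)) ⟩
  SL2.m s · (b · SL2.m (h ⁻¹))          ≡⟨ cong (SL2.m s ·_) (sym s'⁻¹y≡bh⁻¹) ⟩
  SL2.m s · (SL2.m (s' ⁻¹) · y)         ≡⟨ sym (·-assoc (SL2.m s) (SL2.m (s' ⁻¹)) y) ⟩
  (SL2.m s · SL2.m (s' ⁻¹)) · y         ∎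
  where
  open ≡-Reasoning
  s'⁻¹y≡bh⁻¹ : SL2.m (s' ⁻¹) · y ≡ b · SL2.m (h ⁻¹)
  s'⁻¹y≡bh⁻¹ = transposeˡ s' (b · SL2.m (h ⁻¹))
    (trans (transposeʳ y h yh≡s'b) (·-assoc (SL2.m s') b (SL2.m (h ⁻¹))))

minus-times-zero : ∀ i j → i -ℤ j *ℤ +0 ≡ i
minus-times-zero = solve-∀

plus-times-zero : ∀ i j → i +ℤ j *ℤ +0 ≡ i
plus-times-zero = solve-∀

det-toM2 : ∀ {M} (x : Δ M) → det (toM2 x) ≡ + M
det-toM2 {M} x = begin
  + Δ.a x *ℤ + Δ.d x -ℤ + Δ.b x *ℤ +0  ≡⟨ minus-times-zero _ (+ Δ.b x) ⟩
  + Δ.a x *ℤ + Δ.d x                   ≡⟨ sym (ℤP.pos-* (Δ.a x) (Δ.d x)) ⟩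
  + (Δ.a x ℕ.* Δ.d x)                  ≡⟨ cong +_ (Δ.ad≡M x) ⟩
  + M                                  ∎
  where open ≡-Reasoning

unit-positive : ∀ q q' {a b} → q *ℤ q' ≡ + 1 → q *ℤ + a ≡ + b → 0 < a → q ≡ + 1
unit-positive q q' qq'≡1 = positive q ∣q∣≡1
  where
  ∣q∣≡1 : ∣ q ∣ ≡ 1
  ∣q∣≡1 = ℕP.m*n≡1⇒m≡1 ∣ q ∣ ∣ q' ∣ (trans (sym (ℤP.abs-* q q')) (cong ∣_∣ qq'≡1))
  positive : ∀ q {a b} → ∣ q ∣ ≡ 1 → q *ℤ + a ≡ + b → 0 < a → q ≡ + 1
  positive +[1+ zero ] _ _ _ = refl
  positive -[1+ zero ] {suc a} _ () _

stabiliser-unipotent : ∀ {M} (q : SL2) (x y : Δ M) → toM2 x ≡ SL2.m q · toM2 y →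
                       ∃[ t ] SL2.m q ≡ mat (+ 1) t +0 (+ 1)
stabiliser-unipotent (sl (mat q₁ q₂ q₃ q₄) det≡1) x y x≡qy = q₂ , mat≡ q₁≡1 refl q₃≡0 q₄≡1
  where
  lower-left : q₃ *ℤ + Δ.a y ≡ +0
  lower-left = trans (sym (plus-times-zero _ q₄)) (sym (cong M2.c x≡qy))
  q₃≡0 : q₃ ≡ +0
  q₃≡0 with ℤP.i*j≡0⇒i≡0∨j≡0 q₃ lower-left
  ... | inj₁ q₃≡0 = q₃≡0
  ... | inj₂ a≡0 = ⊥-elim (ℕP.<⇒≢ (Δ.0<a y) (sym (ℤP.+-injective a≡0)))
  q₁q₄≡1 : q₁ *ℤ q₄ ≡ + 1
  q₁q₄≡1 = trans (sym (minus-times-zero _ q₂))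
                 (trans (cong (λ z → q₁ *ℤ q₄ -ℤ q₂ *ℤ z) (sym q₃≡0)) det≡1)
  q₁≡1 : q₁ ≡ + 1
  q₁≡1 = unit-positive q₁ q₄ q₁q₄≡1
           (trans (sym (plus-times-zero _ q₂)) (sym (cong M2.a x≡qy))) (Δ.0<a y)
  q₄≡1 : q₄ ≡ + 1
  q₄≡1 = trans (sym (ℤP.*-identityˡ q₄)) (trans (cong (_*ℤ q₄) (sym q₁≡1)) q₁q₄≡1)

shear-action : ∀ t a b d → mat (+ 1) t +0 (+ 1) · mat a b +0 d ≡ mat a (b +ℤ t *ℤ d) +0 d
shear-action t a b d = mat≡ (upper-left t a) (upper-right t b d) (lower-left a) (lower-right b d)
  where
  upper-left : ∀ t a → + 1 *ℤ a +ℤ t *ℤ +0 ≡ a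
  upper-left = solve-∀
  upper-right : ∀ t b d → + 1 *ℤ b +ℤ t *ℤ d ≡ b +ℤ t *ℤ d
  upper-right = solve-∀
  lower-left : ∀ a → +0 *ℤ a +ℤ + 1 *ℤ +0 ≡ +0
  lower-left = solve-∀
  lower-right : ∀ b d → +0 *ℤ b +ℤ + 1 *ℤ d ≡ d
  lower-right = solve-∀

residue-unique : ∀ {x y d} t → x < d → y < d → + x ≡ + y +ℤ t *ℤ + d → x ≡ y
residue-unique {x} {y} {d} +0 _ _ e =
  ℤP.+-injective (trans e (trans (cong (+ y +ℤ_) (ℤP.*-zeroˡ (+ d))) (ℤP.+-identityʳ (+ y))))
residue-unique {x} {y} {d} +[1+ n ] x<d _ e = ⊥-elim (no-positive-shift n x<d e)
  where
  no-positive-shift : ∀ {x y} n → x < d → + x ≡ + y +ℤ +[1+ n ] *ℤ + d → ⊥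
  no-positive-shift {x} {y} n x<d e = ℕP.<⇒≱ x<d (ℕP.≤-trans d≤shift (ℕP.≤-reflexive (sym x≡shift)))
    where
    x≡shift : x ≡ y ℕ.+ suc n ℕ.* d
    x≡shift = ℤP.+-injective (trans e (cong (+ y +ℤ_) (sym (ℤP.pos-* (suc n) d))))
    d≤shift : d ℕ.≤ y ℕ.+ suc n ℕ.* d
    d≤shift = ℕP.≤-trans (ℕP.m≤m+n d (n ℕ.* d)) (ℕP.m≤n+m _ y)
residue-unique {x} {y} {d} -[1+ n ] x<d y<d e = sym (residue-unique +[1+ n ] y<d x<d y≡x+shift)
  where
  negate-shift : ∀ i j t k → i ≡ j +ℤ t *ℤ k → j ≡ i +ℤ (-ℤ t) *ℤ k
  negate-shift i j t k refl = solve-equation j t k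
    where
    solve-equation : ∀ j t k → j ≡ (j +ℤ t *ℤ k) +ℤ (-ℤ t) *ℤ k
    solve-equation = solve-∀
  y≡x+shift : + y ≡ + x +ℤ +[1+ n ] *ℤ + d
  y≡x+shift = negate-shift (+ x) (+ y) -[1+ n ] (+ d) e

Δ-rigid : ∀ {M} (q : SL2) (x y : Δ M) → toM2 x ≡ SL2.m q · toM2 y → toM2 x ≡ toM2 y
Δ-rigid q x y x≡qy = mat≡ (cong M2.a x≡shear) (cong +_ b-equal) refl (cong M2.d x≡shear)
  where
  t : ℤ
  t = proj₁ (stabiliser-unipotent q x y x≡qy)
  x≡shear : toM2 x ≡ mat (+ Δ.a y) (+ Δ.b y +ℤ t *ℤ + Δ.d y) +0 (+ Δ.d y)
  x≡shear = trans x≡qy (trans (cong (_· toM2 y) (proj₂ (stabiliser-unipotent q x y x≡qy)))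
                              (shear-action t (+ Δ.a y) (+ Δ.b y) (+ Δ.d y)))
  b-equal : Δ.b x ≡ Δ.b y
  b-equal = residue-unique t (subst (Δ.b x <_) (ℤP.+-injective (cong M2.d x≡shear)) (Δ.b<d x))
                             (Δ.b<d y) (cong M2.b x≡shear)

sameΔ-reflects : ∀ {M} (x y : Δ M) → Reflects (toM2 x ≡ toM2 y) (sameΔ x y)
sameΔ-reflects x y = proof (map′ entries→matrix matrix→entries
  ((Δ.a x ℕ.≟ Δ.a y) ×-dec ((Δ.b x ℕ.≟ Δ.b y) ×-dec (Δ.d x ℕ.≟ Δ.d y))))
  where
  entries→matrix : Δ.a x ≡ Δ.a y × Δ.b x ≡ Δ.b y × Δ.d x ≡ Δ.d y → toM2 x ≡ toM2 y
  entries→matrix (a≡ , b≡ , d≡) = mat≡ (cong +_ a≡) (cong +_ b≡) refl (cong +_ d≡)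
  matrix→entries : toM2 x ≡ toM2 y → Δ.a x ≡ Δ.a y × Δ.b x ≡ Δ.b y × Δ.d x ≡ Δ.d y
  matrix→entries x≡y = ℤP.+-injective (cong M2.a x≡y) , ℤP.+-injective (cong M2.b x≡y)
                     , ℤP.+-injective (cong M2.d x≡y)

module Representatives {M : ℕ} (D : Decomposition M) where
  open Decomposition D

  I-bar-spec : ∀ (x : Δ M) h → toM2 x · SL2.m h ≡ SL2.m (I D x h) · toM2 (bar D x h)
  I-bar-spec x h = spec _ (trans (det-· (toM2 x) (SL2.m h))
    (trans (cong₂ _*ℤ_ (det-toM2 x) (SL2.det≡1 h)) (ℤP.*-identityʳ (+ M))))

  I-cong : ∀ (x y : Δ M) h → toM2 x ≡ toM2 y → I D x h ≡ I D y h
  I-cong x y h x≡y = cong (λ z → proj₁ (decompose (z · SL2.m h))) x≡y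

  bar-cong : ∀ (x y : Δ M) h → toM2 x ≡ toM2 y → toM2 (bar D x h) ≡ toM2 (bar D y h)
  bar-cong x y h x≡y = cong (λ z → toM2 (proj₂ (decompose (z · SL2.m h)))) x≡y

  bar-injective : ∀ (x y : Δ M) h → toM2 (bar D x h) ≡ toM2 (bar D y h) → toM2 x ≡ toM2 y
  bar-injective x y h bars≡ = Δ-rigid (I D x h ∘SL I D y h ⁻¹) x y
    (same-orbit h (I D x h) (I D y h) (I-bar-spec x h)
      (trans (I-bar-spec y h) (cong (SL2.m (I D y h) ·_) (sym bars≡))))

module Isometry {c ℓ m ℓm : Level} {K : CommutativeRing c ℓ}
                {conj : CommutativeRing.Carrier K → CommutativeRing.Carrier K}
                {H : InnerProductSpace K conj m ℓm} (R : UnitaryRep H)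
                {M : ℕ} (D : Decomposition M) where
  open CommutativeRing K
    using (_≈_; _+_; 0#; setoid; +-cong; +-congʳ; +-assoc; +-identityʳ)
    renaming (refl to ≈-refl; sym to ≈-sym)
  open InnerProductSpace H
  open LeftModule V using (Carrierᴹ)
  open UnitaryRep R
  open TensorDefs R D
  open Representatives D
  open SetoidReasoning setoid

  Pure : Set m
  Pure = Carrierᴹ × Δ M

  row-split : ∀ p xs ys → ⟪ p ∷ xs , ys ⟫ ≈ ⟪ p ∷ [] , ys ⟫ + ⟪ xs , ys ⟫
  row-split p xs ys = +-congʳ (≈-sym (+-identityʳ _))

  row-cons : ∀ p q ys → ⟪ p ∷ [] , q ∷ ys ⟫ ≈ ⟪ p , q ⟫pure + ⟪ p ∷ [] , ys ⟫
  row-cons p q ys = begin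
    (⟪ p , q ⟫pure + _) + 0#  ≈⟨ +-assoc _ _ 0# ⟩
    ⟪ p , q ⟫pure + (_ + 0#)  ∎

  map-isometry : (f : Pure → Pure) → (∀ p q → ⟪ f p , f q ⟫pure ≈ ⟪ p , q ⟫pure) →
                 ∀ xs ys → ⟪ map f xs , map f ys ⟫ ≈ ⟪ xs , ys ⟫
  map-isometry f f-pure [] ys = ≈-refl
  map-isometry f f-pure (p ∷ xs) ys = begin
    ⟪ f p ∷ map f xs , map f ys ⟫                 ≈⟨ row-split (f p) (map f xs) (map f ys) ⟩
    ⟪ f p ∷ [] , map f ys ⟫ + ⟪ map f xs , map f ys ⟫
      ≈⟨ +-cong (row-isometry ys) (map-isometry f f-pure xs ys) ⟩
    ⟪ p ∷ [] , ys ⟫ + ⟪ xs , ys ⟫                  ≈⟨ row-split p xs ys ⟨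
    ⟪ p ∷ xs , ys ⟫                               ∎
    where
    row-isometry : ∀ ys → ⟪ f p ∷ [] , map f ys ⟫ ≈ ⟪ p ∷ [] , ys ⟫
    row-isometry [] = ≈-refl
    row-isometry (q ∷ ys) = begin
      ⟪ f p ∷ [] , f q ∷ map f ys ⟫              ≈⟨ row-cons (f p) (f q) (map f ys) ⟩
      ⟪ f p , f q ⟫pure + ⟪ f p ∷ [] , map f ys ⟫ ≈⟨ +-cong (f-pure p q) (row-isometry ys) ⟩
      ⟪ p , q ⟫pure + ⟪ p ∷ [] , ys ⟫            ≈⟨ row-cons p q ys ⟨
      ⟪ p ∷ [] , q ∷ ys ⟫                        ∎

  -- (T_M ρ)(γ) preserves the inner product of pure tensors: by injectivity of
  -- m ↦ \overline{mh} the two Δ_M-tests agree, and when they succeed both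
  -- vectors are moved by the same unitary ρ(I_m(h))⁻¹.
  Tpure-isometry : ∀ γ p q → ⟪ Tpure γ p , Tpure γ q ⟫pure ≈ ⟪ p , q ⟫pure
  Tpure-isometry γ (v , x) (w , y) =
    compare (γ ⁻¹) (sameΔ-reflects x y) (sameΔ-reflects (bar D x (γ ⁻¹)) (bar D y (γ ⁻¹)))
    where
    compare : ∀ h {b b'} → Reflects (toM2 x ≡ toM2 y) b →
              Reflects (toM2 (bar D x h) ≡ toM2 (bar D y h)) b' →
              (if b' then ⟨ ρ (I D x h ⁻¹) v , ρ (I D y h ⁻¹) w ⟩ else 0#)
              ≈ (if b then ⟨ v , w ⟩ else 0#)
    compare h (ofʸ x≡y) (ofʸ _)        =
      subst (λ g → ⟨ ρ (I D x h ⁻¹) v , ρ (g ⁻¹) w ⟩ ≈ ⟨ v , w ⟩) (I-cong x y h x≡y) (unitary _ v w)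
    compare h (ofʸ x≡y) (ofⁿ bars≢)    = ⊥-elim (bars≢ (bar-cong x y h x≡y))
    compare h (ofⁿ x≢y) (ofʸ bars≡)    = ⊥-elim (x≢y (bar-injective x y h bars≡))
    compare h (ofⁿ _)   (ofⁿ _)        = ≈-refl

lemma2p4 : {c ℓ m ℓm : Level} (K : CommutativeRing c ℓ)
           (conj : CommutativeRing.Carrier K → CommutativeRing.Carrier K)
           (H : InnerProductSpace K conj m ℓm) (R : UnitaryRep H)
           (M : ℕ) → 0 < M → (D : Decomposition M) →
           ∀ γ xs ys →
           CommutativeRing._≈_ K
             (TensorDefs.⟪_,_⟫ R D (TensorDefs.T R D γ xs) (TensorDefs.T R D γ ys))
             (TensorDefs.⟪_,_⟫ R D xs ys)
lemma2p4 K conj H R M _ D γ = map-isometry (Tpure γ) (Tpure-isometry γ)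
  where
  open Isometry R D
  open TensorDefs R D using (Tpure)
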